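{- For every $i\in\mathbb{N}$, there exist $i$ distinct closed subsemigroups of $\mathbb{N}^\mathbb{N}$, each contained in $\mathfrak{F}$, that are pairwise incomparable under $\preccurlyeq$.
   Context: $\mathbb{N}=\{0,1,2,\ldots\}$ and $\mathbb{N}^\mathbb{N}$ is the semigroup of all maps $\mathbb{N}\to\mathbb{N}$ under composition, with the product topology arising from the discrete topology on $\mathbb{N}$ ("closed" refers to this topology). $\mathfrak{F}$ is the set of all $f\in\mathbb{N}^\mathbb{N}$ with finite image. For $U,V\subseteq\mathbb{N}^\mathbb{N}$, $U\preccurlyeq V$ means there is a countable $C\subseteq\mathbb{N}^\mathbb{N}$ such that $U$ is contained in the subsemigroup generated by $V\cup C$; $U,V$ are incomparable if neither $U\preccurlyeq V$ nor $V\preccurlyeq U$. -}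

module Defs where

open import Data.Nat using (ℕ; _<_)
open import Data.Fin using (Fin)
open import Data.List using (List)
open import Data.List.Membership.Propositional using (_∈_)
open import Data.Product using (Σ; _×_; ∃)
open import Data.Sum using (_⊎_)
open import Relation.Nullary using (¬_)
open import Relation.Binary.PropositionalEquality using (_≡_)
open import Level using (Level; suc; zero)

Map : Set
Map = ℕ → ℕ

Subset : Set₁
Subset = Map → Set

_⊆_ : Subset → Subset → Set
U ⊆ V = ∀ f → U f → V f

_∪_ : Subset → Subset → Subset
(U ∪ V) f = U f ⊎ V f

_·_ : Map → Map → Map
(f · g) x = f (g x)

IsSubsemigroup : Subset → Set
IsSubsemigroup U = ∀ f g → U f → U g → U (f · g)

-- Closed in the product topology (discrete ℕ): U contains every f all of
-- whose basic neighbourhoods {g | g agrees with f below n} meet U.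
IsClosed : Subset → Set
IsClosed U = ∀ f → (∀ n → Σ Map λ g → U g × (∀ x → x < n → g x ≡ f x)) → U f

𝔉 : Subset
𝔉 f = Σ (List ℕ) λ L → ∀ x → f x ∈ L

data Gen (W : Subset) : Subset where
  base : ∀ {f} g → W g → (∀ x → g x ≡ f x) → Gen W f
  comp : ∀ {f} g h → Gen W g → Gen W h → (∀ x → g (h x) ≡ f x) → Gen W f

-- Range of a sequence of maps (a countable set; adding generators only
-- enlarges Gen, so nonempty countable sets suffice)
Range : (ℕ → Map) → Subset
Range c f = Σ ℕ λ n → ∀ x → c n x ≡ f x

_≼_ : Subset → Subset → Set
U ≼ V = Σ (ℕ → Map) λ c → U ⊆ Gen (V ∪ Range c)

Incomparable : Subset → Subset → Set
Incomparable U V = ¬ (U ≼ V) × ¬ (V ≼ U)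

_≐_ : Subset → Subset → Set
U ≐ V = U ⊆ V × V ⊆ U

-- Points x ≥ r carry a label: a chain number l and a node s of the infinite
-- binary tree, the nodes being ordered in-order (a dense linear order ⊑).
-- A cut map for (r , p) fixes 0 … r-1, vanishes on the chains l ≥ p, and on
-- each chain l < p is the 0/1 indicator of an up-set of nodes.  The cut maps
-- for (r , p) form a closed subsemigroup of 𝔉, since each of them fixes all
-- values of the others.
--
-- Separation: every member of the semigroup generated by the cut maps for
-- (r′ , p′) and a sequence c is a composite of c's or a sandwich
-- t ∘ w ∘ (composite of c's) with w a cut map (NormalForm).  Enumerating all
-- such candidates, we build a cut map for (r , p) chain by chain as the cut
-- of a branch chosen bit by bit (Diagonal): chain 0 defeats composites and,
-- when p′ + 3 ≤ p, chains 1 … p′ + 2 defeat sandwiches by a pigeonhole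
-- argument (Targets); when r′ < r, sandwiches take too few values anyway.
-- Taking r = j + 2 and p = 3 (i - j) for j < i gives the theorem.
module Submission where

open import Defs
open import Data.Bool using (Bool; true; false; not)
open import Data.Empty using (⊥)
open import Data.Fin using (Fin; toℕ; fromℕ<)
open import Data.Fin.Properties using (pigeonhole; toℕ<n; toℕ-injective; fromℕ<-injective)
open import Data.List using (List; []; _∷_; _++_; _∷ʳ_; length; lookup; applyUpTo)
open import Data.List.Membership.Propositional using (_∈_)
open import Data.List.Membership.Propositional.Properties using (∈-applyUpTo⁺)
open import Data.List.Properties using (length-applyUpTo; applyUpTo-∷ʳ)
open import Data.List.Relation.Unary.Any using (index)
open import Data.List.Relation.Unary.Any.Properties using (lookup-index)
open import Data.Nat using (ℕ; zero; suc; _+_; _∸_; _*_; _≤_; _<_; z≤n; s≤s; _<?_; _≟_)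
open import Data.Nat.Properties
open import Data.Product using (Σ; _×_; _,_; proj₁; proj₂)
import Data.Product as Product
open import Data.Sum using (_⊎_; inj₁; inj₂; [_,_])
import Data.Sum as Sum
open import Function using (_∘_; id)
open import Relation.Binary.Definitions using (tri<; tri≈; tri>)
open import Relation.Binary.PropositionalEquality using (_≡_; refl; sym; trans; cong; cong₂; subst; subst₂; module ≡-Reasoning)
open import Relation.Nullary using (¬_; yes; no; contradiction)

Enumerates : {A : Set} → (ℕ → A) → Set
Enumerates {A} e = ∀ a → Σ ℕ λ n → e n ≡ a

next : ℕ × ℕ → ℕ × ℕ
next (zero , k) = suc k , 0
next (suc m , k) = m , suc k

unpair : ℕ → ℕ × ℕ
unpair zero = 0 , 0
unpair (suc n) = next (unpair n)

-- Every pair is reached: walk down the diagonal m + k from (m + k , 0),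
-- which is itself reached from (m + k - 1 , 0) by a full diagonal.
unpair-enumerates : Enumerates unpair
unpair-enumerates (m , k) = along k m (start (m + k))
  where
  Reached : ℕ × ℕ → Set
  Reached q = Σ ℕ λ n → unpair n ≡ q

  along : ∀ k m → Reached (m + k , 0) → Reached (m , k)
  along zero m h rewrite +-identityʳ m = h
  along (suc k) m h with along k (suc m) (subst (λ s → Reached (s , 0)) (+-suc m k) h)
  ... | n , e = suc n , cong next e

  start : ∀ s → Reached (s , 0)
  start zero = 0 , refl
  start (suc s) with along s 0 (start s)
  ... | n , e = suc n , cong next e

_⊗_ : {A B : Set} → (ℕ → A) → (ℕ → B) → ℕ → A × B
(e ⊗ e′) n = e (proj₁ (unpair n)) , e′ (proj₂ (unpair n))

⊗-enumerates : {A B : Set} {e : ℕ → A} {e′ : ℕ → B} →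
  Enumerates e → Enumerates e′ → Enumerates (e ⊗ e′)
⊗-enumerates {e = e} {e′} he he′ (a , b) with he a | he′ b
... | i , refl | j , refl with unpair-enumerates (i , j)
... | n , eq = n , cong (λ q → e (proj₁ q) , e′ (proj₂ q)) eq

tuples : {A : Set} → (ℕ → A) → ℕ → ℕ → List A
tuples e zero n = []
tuples e (suc k) n = e (proj₁ (unpair n)) ∷ tuples e k (proj₂ (unpair n))

tuples-enumerates : {A : Set} {e : ℕ → A} → Enumerates e →
  ∀ xs → Σ ℕ λ n → tuples e (length xs) n ≡ xs
tuples-enumerates he [] = 0 , refl
tuples-enumerates {e = e} he (x ∷ xs) with he x | tuples-enumerates he xs
... | i , refl | j , eq with unpair-enumerates (i , j)
... | n , eqn = n , cong₂ _∷_ (cong (e ∘ proj₁) eqn)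
                      (trans (cong (tuples e (length xs) ∘ proj₂) eqn) eq)

lists : {A : Set} → (ℕ → A) → ℕ → List A
lists e n = tuples e (proj₁ (unpair n)) (proj₂ (unpair n))

lists-enumerates : {A : Set} {e : ℕ → A} → Enumerates e → Enumerates (lists e)
lists-enumerates {e = e} he xs with tuples-enumerates he xs
... | j , eq with unpair-enumerates (length xs , j)
... | n , eqn = n , trans (cong (λ q → tuples e (proj₁ q) (proj₂ q)) eqn) eq

id-enumerates : Enumerates id
id-enumerates n = n , refl

-- Binary words are coded by lists of naturals through isZero.
isZero : ℕ → Bool
isZero zero = true
isZero (suc _) = false

isZero-enumerates : Enumerates isZero
isZero-enumerates true = 0 , refl
isZero-enumerates false = 1 , refl

-- Points x ≥ r are labelled by a chain number and a finite binary word;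
-- every label is carried by some point.
labels : ℕ → ℕ × List Bool
labels = id ⊗ lists isZero

chain : ℕ → ℕ → ℕ
chain r x = proj₁ (labels (x ∸ r))

word : ℕ → ℕ → List Bool
word r x = proj₂ (labels (x ∸ r))

labels-enumerates : Enumerates labels
labels-enumerates = ⊗-enumerates id-enumerates (lists-enumerates isZero-enumerates)

point : ℕ → ℕ → List Bool → ℕ
point r l s = r + proj₁ (labels-enumerates (l , s))

point-≥ : ∀ r l s → r ≤ point r l s
point-≥ r l s = m≤m+n r _

point-label : ∀ r l s → labels (point r l s ∸ r) ≡ (l , s)
point-label r l s rewrite m+n∸m≡n r (proj₁ (labels-enumerates (l , s))) =
  proj₂ (labels-enumerates (l , s))

-- The in-order of the nodes of the infinite binary tree (false = left,
-- true = right): left subtree < root < right subtree.  It is a dense order.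
_⊑_ : List Bool → List Bool → Bool
[] ⊑ [] = true
[] ⊑ (b ∷ _) = b
(b ∷ _) ⊑ [] = not b
(true ∷ s) ⊑ (true ∷ t) = s ⊑ t
(false ∷ s) ⊑ (false ∷ t) = s ⊑ t
(true ∷ _) ⊑ (false ∷ _) = false
(false ∷ _) ⊑ (true ∷ _) = true

⊑-total : ∀ s t → s ⊑ t ≡ true ⊎ t ⊑ s ≡ true
⊑-total [] [] = inj₁ refl
⊑-total [] (true ∷ t) = inj₁ refl
⊑-total [] (false ∷ t) = inj₂ refl
⊑-total (true ∷ s) [] = inj₂ refl
⊑-total (false ∷ s) [] = inj₁ refl
⊑-total (true ∷ s) (true ∷ t) = ⊑-total s t
⊑-total (false ∷ s) (false ∷ t) = ⊑-total s t
⊑-total (true ∷ s) (false ∷ t) = inj₂ refl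
⊑-total (false ∷ s) (true ∷ t) = inj₁ refl

-- An infinite branch τ cuts the order: 'above s τ' says that the node s lies
-- to the right of τ.  Distinct branches give distinct cuts, which is what
-- makes the cut maps below too numerous for a countable family.
above : List Bool → (ℕ → Bool) → Bool
above [] τ = not (τ 0)
above (b ∷ s) τ with b | τ 0
... | true | true = above s (τ ∘ suc)
... | false | false = above s (τ ∘ suc)
... | true | false = true
... | false | true = false

above-upward : ∀ s t τ → s ⊑ t ≡ true → above s τ ≡ true → above t τ ≡ true
above-upward [] [] τ _ h = h
above-upward [] (true ∷ t) τ _ h with τ 0
... | true = contradiction h λ ()
... | false = refl
above-upward (false ∷ s) [] τ _ h with τ 0
... | true = contradiction h λ ()
... | false = refl
above-upward (true ∷ s) (true ∷ t) τ le h with τ 0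
... | true = above-upward s t (τ ∘ suc) le h
... | false = refl
above-upward (false ∷ s) (false ∷ t) τ le h with τ 0
... | true = h
... | false = above-upward s t (τ ∘ suc) le h
above-upward (false ∷ s) (true ∷ t) τ _ h with τ 0
... | true = contradiction h λ ()
... | false = refl
above-upward [] (false ∷ t) τ () h
above-upward (true ∷ s) [] τ () h
above-upward (true ∷ s) (false ∷ t) τ () h

above-prefix : ∀ n τ → above (applyUpTo τ n) τ ≡ not (τ n)
above-prefix zero τ = refl
above-prefix (suc n) τ with τ 0
... | true = above-prefix n (τ ∘ suc)
... | false = above-prefix n (τ ∘ suc)

record CutMap (r p : ℕ) (w : Map) : Set where
  field
    fixes    : ∀ x → x < r → w x ≡ x
    binary   : ∀ x → r ≤ x → w x ≤ 1
    vanishes : ∀ x → r ≤ x → p ≤ chain r x → w x ≡ 0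
    monotone : ∀ x y → r ≤ x → r ≤ y → chain r x ≡ chain r y → chain r x < p →
               word r x ⊑ word r y ≡ true → w x ≤ w y
open CutMap

cutMap-ext : ∀ {r p w v} → CutMap r p w → (∀ x → w x ≡ v x) → CutMap r p v
cutMap-ext {r} {p} {w} {v} W eq = record
  { fixes    = λ x h → trans (sym (eq x)) (fixes W x h)
  ; binary   = λ x h → subst (_≤ 1) (eq x) (binary W x h)
  ; vanishes = λ x h h′ → trans (sym (eq x)) (vanishes W x h h′)
  ; monotone = λ x y hx hy hc hp hl → subst₂ _≤_ (eq x) (eq y) (monotone W x y hx hy hc hp hl)
  }

cutMap-values : ∀ {r p w} → 2 ≤ r → CutMap r p w → ∀ x → w x < r
cutMap-values {r} r≥2 W x with x <? r
... | yes x<r = subst (_< r) (sym (fixes W x x<r)) x<r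
... | no x≮r = ≤-<-trans (binary W x (≮⇒≥ x≮r)) r≥2

-- Hence w · w′ agrees with w′, since w fixes every value of w′.
cutMap-semigroup : ∀ {r p} → 2 ≤ r → IsSubsemigroup (CutMap r p)
cutMap-semigroup r≥2 w w′ W W′ =
  cutMap-ext W′ (λ x → sym (fixes W (w′ x) (cutMap-values r≥2 W′ x)))

cutMap-finite : ∀ {r p} → 2 ≤ r → CutMap r p ⊆ 𝔉
cutMap-finite {r} r≥2 w W = applyUpTo id r , λ x → ∈-applyUpTo⁺ id (cutMap-values r≥2 W x)

-- Each defining condition constrains the values at two points only, so it
-- passes to limits.
cutMap-closed : ∀ {r p} → IsClosed (CutMap r p)
cutMap-closed {r} {p} f near = record
  { fixes    = λ x h → atTwo x x (λ a _ → a ≡ x) (λ g G → fixes G x h)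
  ; binary   = λ x h → atTwo x x (λ a _ → a ≤ 1) (λ g G → binary G x h)
  ; vanishes = λ x h h′ → atTwo x x (λ a _ → a ≡ 0) (λ g G → vanishes G x h h′)
  ; monotone = λ x y hx hy hc hp hl → atTwo x y _≤_ (λ g G → monotone G x y hx hy hc hp hl)
  }
  where
  atTwo : ∀ x y (P : ℕ → ℕ → Set) → (∀ g → CutMap r p g → P (g x) (g y)) → P (f x) (f y)
  atTwo x y P h with near (suc (x + y))
  ... | g , G , agree = subst₂ P (agree x (s≤s (m≤m+n x y))) (agree y (s≤s (m≤n+m y x))) (h g G)

eval : (ℕ → Map) → List ℕ → Map
eval c [] x = x
eval c (n ∷ ω) x = c n (eval c ω x)

eval-++ : ∀ c ω ω′ x → eval c (ω ++ ω′) x ≡ eval c ω (eval c ω′ x)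
eval-++ c [] ω′ x = refl
eval-++ c (n ∷ ω) ω′ x = cong (c n) (eval-++ c ω ω′ x)

-- Finite tables: nth t k is the k-th entry of t (0 beyond its end).
nth : List ℕ → ℕ → ℕ
nth [] _ = 0
nth (x ∷ xs) zero = x
nth (x ∷ xs) (suc k) = nth xs k

nth-applyUpTo : ∀ g n k → k < n → nth (applyUpTo g n) k ≡ g k
nth-applyUpTo g (suc n) zero _ = refl
nth-applyUpTo g (suc n) (suc k) (s≤s k<n) = nth-applyUpTo (g ∘ suc) n k k<n

FewValues : ℕ → Subset
FewValues n g = Σ (List ℕ) λ L → length L ≤ n × (∀ x → g x ∈ L)

Composite : (ℕ → Map) → Subset
Composite c g = Σ (List ℕ) λ ω → ∀ x → g x ≡ eval c ω x

Sandwich : ℕ → ℕ → (ℕ → Map) → Subset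
Sandwich r p c g = Σ (List ℕ) λ t → Σ (List ℕ) λ ω → Σ Map λ w →
  CutMap r p w × (∀ x → g x ≡ nth t (w (eval c ω x)))

-- A cut map is a sandwich with the identity table, and since the
-- middle cut map only takes the values 0 … r-1, any map composed on the left
-- of a sandwich merges into its table (left-absorb), while composites on the
-- right merge into its word (right-absorb).
module NormalForm (r p : ℕ) (r≥2 : 2 ≤ r) (c : ℕ → Map) where

  NF : Subset
  NF g = Composite c g ⊎ Sandwich r p c g

  sandwich-few-values : ∀ {g} → Sandwich r p c g → FewValues r g
  sandwich-few-values (t , ω , w , W , q) =
    applyUpTo (nth t) r , ≤-reflexive (length-applyUpTo (nth t) r) ,
    λ x → subst (_∈ applyUpTo (nth t) r) (sym (q x)) (∈-applyUpTo⁺ (nth t) (cutMap-values r≥2 W _))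

  left-absorb : ∀ g {h} → Sandwich r p c h → Sandwich r p c (g · h)
  left-absorb g (t , ω , w , W , q) =
    applyUpTo (g ∘ nth t) r , ω , w , W ,
    λ x → trans (cong g (q x)) (sym (nth-applyUpTo (g ∘ nth t) r _ (cutMap-values r≥2 W _)))

  right-absorb : ∀ {g h} → Sandwich r p c g → Composite c h → Sandwich r p c (g · h)
  right-absorb {g} {h} (t , ω , w , W , q) (ω′ , q′) =
    t , ω ++ ω′ , w , W ,
    λ x → trans (q (h x)) (cong (nth t ∘ w) (trans (cong (eval c ω) (q′ x)) (sym (eval-++ c ω ω′ x))))

  composite-comp : ∀ {g h} → Composite c g → Composite c h → Composite c (g · h)
  composite-comp {g} {h} (ω , q) (ω′ , q′) =
    ω ++ ω′ , λ x → trans (q (h x)) (trans (cong (eval c ω) (q′ x)) (sym (eval-++ c ω ω′ x)))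

  NF-comp : ∀ g h → NF g → NF h → NF (g · h)
  NF-comp g h _ (inj₂ sh) = inj₂ (left-absorb g sh)
  NF-comp g h (inj₁ cg) (inj₁ ch) = inj₁ (composite-comp cg ch)
  NF-comp g h (inj₂ sg) (inj₁ ch) = inj₂ (right-absorb sg ch)

  NF-ext : ∀ {g f} → NF g → (∀ x → g x ≡ f x) → NF f
  NF-ext (inj₁ (ω , q)) e = inj₁ (ω , λ x → trans (sym (e x)) (q x))
  NF-ext (inj₂ (t , ω , w , W , q)) e = inj₂ (t , ω , w , W , λ x → trans (sym (e x)) (q x))

  normal-form : ∀ {f} → Gen (CutMap r p ∪ Range c) f → NF f
  normal-form (base g (inj₁ W) e) =
    NF-ext (inj₂ (applyUpTo id r , [] , g , W , λ x → sym (nth-applyUpTo id r _ (cutMap-values r≥2 W x)))) e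
  normal-form (base g (inj₂ (n , q)) e) = NF-ext (inj₁ (n ∷ [] , λ x → sym (q x))) e
  normal-form (comp g h Gg Gh e) = NF-ext (NF-comp g h (normal-form Gg) (normal-form Gh)) e

-- A cut map for (r , p) takes r distinct values, so no more than n < r
-- values is impossible.
many-values : ∀ {r p n f} → CutMap r p f → n < r → ¬ FewValues n f
many-values {r} {f = f} F n<r (L , len , inL) with pigeonhole (≤-<-trans len n<r) (λ i → index (inL (toℕ i)))
... | i , j , i<j , same = <-irrefl (cong toℕ (toℕ-injective i≡j)) i<j
  where
  fixed : ∀ (k : Fin r) → toℕ k ≡ lookup L (index (inL (toℕ k)))
  fixed k = trans (sym (fixes F (toℕ k) (toℕ<n k))) (lookup-index (inL (toℕ k)))
  i≡j : toℕ i ≡ toℕ j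
  i≡j = trans (fixed i) (trans (cong (lookup L) same) (sym (fixed j)))

zero-or-one : ∀ {a b} → a ≤ b → b ≤ 1 → a ≡ 0 ⊎ b ≡ 1
zero-or-one {zero} _ _ = inj₁ refl
zero-or-one {suc _} {suc zero} _ _ = inj₂ refl
zero-or-one {suc _} {suc (suc _)} _ (s≤s ())

-- For the cut maps w for (r , p): the value w u is either determined by u
-- alone (category 0) or u lies on a chain l < p (category l + 1).  Two points
-- of equal category can be tested by two positions 'targets u v' so that
-- every such w hits at least one of them; this defeats any attempt to encode
-- two independent bits by the values of a cut map.
module Targets (r p : ℕ) where

  category : ℕ → ℕ
  category u with u <? r
  ... | yes _ = 0
  ... | no _ with chain r u <? p
  ... | yes _ = suc (chain r u)
  ... | no _ = 0

  data CategoryView (u : ℕ) : ℕ → Set where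
    fixed   : ∀ k → (∀ {w} → CutMap r p w → w u ≡ k) → CategoryView u 0
    onChain : r ≤ u → chain r u < p → CategoryView u (suc (chain r u))

  -- Below r a cut map is the identity, beyond chain p it vanishes.
  category-view : ∀ u → CategoryView u (category u)
  category-view u with u <? r
  ... | yes u<r = fixed u (λ W → fixes W u u<r)
  ... | no u≮r with chain r u <? p
  ... | yes l<p = onChain (≮⇒≥ u≮r) l<p
  ... | no l≮p = fixed 0 (λ W → vanishes W u (≮⇒≥ u≮r) (≮⇒≥ l≮p))

  category< : ∀ u → category u < suc p
  category< u with category u | category-view u
  ... | _ | fixed _ _ = s≤s z≤n
  ... | _ | onChain _ l<p = s≤s l<p

  -- On a common chain, w is monotone from the ⊑-smaller point to the larger:
  -- it is 0 at the smaller or 1 at the larger one.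
  order : Bool → ℕ × ℕ
  order true = 0 , 1
  order false = 1 , 0

  targets : ℕ → ℕ → ℕ × ℕ
  targets u v with category u | category-view u
  ... | _ | fixed k _ = k , 0
  ... | _ | onChain _ _ = order (word r u ⊑ word r v)

  hits-target : ∀ {w} u v → CutMap r p w → category u ≡ category v →
                w u ≡ proj₁ (targets u v) ⊎ w v ≡ proj₂ (targets u v)
  hits-target {w} u v W same with category u | category-view u
  ... | _ | fixed k value = inj₁ (value W)
  ... | _ | onChain ru lu with category v | category-view v
  ...   | _ | fixed _ _ = contradiction same λ ()
  ...   | _ | onChain rv lv = along-chain (word r u ⊑ word r v) refl
    where
    sameChain : chain r u ≡ chain r v
    sameChain = suc-injective same
    along-chain : ∀ b → word r u ⊑ word r v ≡ b → w u ≡ proj₁ (order b) ⊎ w v ≡ proj₂ (order b)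
    along-chain true u⊑v = zero-or-one (monotone W u v ru rv sameChain lu u⊑v) (binary W v rv)
    along-chain false u⋢v with ⊑-total (word r u) (word r v)
    ... | inj₁ u⊑v = contradiction (trans (sym u⋢v) u⊑v) λ ()
    ... | inj₂ v⊑u = Sum.swap
          (zero-or-one (monotone W v u rv ru (sym sameChain) (subst (_< p) sameChain lu) v⊑u) (binary W u ru))

-- The diagonal map takes the value avoid z wherever a candidate takes z.
avoid : ℕ → ℕ
avoid zero = 1
avoid (suc _) = 0

avoid-≢ : ∀ z → ¬ (avoid z ≡ z)
avoid-≢ zero ()
avoid-≢ (suc _) ()

indicator : Bool → ℕ
indicator true = 1
indicator false = 0

indicator-≤1 : ∀ b → indicator b ≤ 1
indicator-≤1 true = s≤s z≤n
indicator-≤1 false = z≤n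

indicator-mono : ∀ {a b} → (a ≡ true → b ≡ true) → indicator a ≤ indicator b
indicator-mono {false} _ = z≤n
indicator-mono {true} {true} _ = s≤s z≤n
indicator-mono {true} {false} h = contradiction (h refl) λ ()

-- The branch bit after a prefix that makes the prefix node have indicator
-- value avoid z (see above-prefix).
aim : ℕ → Bool
aim z = not (isZero z)

indicator-aim : ∀ z → indicator (not (aim z)) ≡ avoid z
indicator-aim zero = refl
indicator-aim (suc _) = refl

pick : ℕ → ℕ → Bool → Bool → ℕ → Bool
pick i j b₁ b₂ l with l ≟ i
... | yes _ = b₁
... | no _ with l ≟ j
... | yes _ = b₂
... | no _ = false

pick-first : ∀ i j b₁ b₂ → pick i j b₁ b₂ i ≡ b₁
pick-first i j b₁ b₂ with i ≟ i
... | yes _ = refl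
... | no i≢i = contradiction refl i≢i

pick-second : ∀ i j b₁ b₂ → ¬ (j ≡ i) → pick i j b₁ b₂ j ≡ b₂
pick-second i j b₁ b₂ j≢i with j ≟ i
... | yes j≡i = contradiction j≡i j≢i
... | no _ with j ≟ j
... | yes _ = refl
... | no j≢j = contradiction refl j≢j

-- The candidates to diagonalise against: a word ω (for composites) and a
-- table t with a word ω′ (for sandwiches t ∘ w ∘ eval c ω′).
candidates : ℕ → List ℕ × List ℕ × List ℕ
candidates = lists id ⊗ (lists id ⊗ lists id)

candidates-enumerate : Enumerates candidates
candidates-enumerate = ⊗-enumerates ids (⊗-enumerates ids ids)
  where
  ids : Enumerates (lists id)
  ids = lists-enumerates id-enumerates

-- Chain l of the diagonal is the cut of a branch 'branch l'
-- built bit by bit; at stage n, with the prefixes of length n fixed, the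
-- next bits defeat candidate n.  The node 'witness Q l' at the end of the
-- current prefix on chain l receives value avoid z when the next bit is aim z.
module Diagonal (r p r′ p′ : ℕ) (c : ℕ → Map) where
  open Targets r′ p′

  witness : (ℕ → List Bool) → ℕ → ℕ
  witness Q l = point r l (Q l)

  -- Against a sandwich we probe chains 1 … p′ + 2: more probes than there
  -- are categories for (r′ , p′), so two probes collide.
  probes : ℕ
  probes = suc (suc p′)

  probe : (ℕ → List Bool) → Fin probes → ℕ
  probe Q i = witness Q (suc (toℕ i))

  record Collision (ω′ : List ℕ) (Q : ℕ → List Bool) : Set where
    field
      first second : Fin probes
      ordered      : toℕ first < toℕ second
      sameCategory : category (eval c ω′ (probe Q first)) ≡ category (eval c ω′ (probe Q second))

    positions : ℕ × ℕ
    positions = targets (eval c ω′ (probe Q first)) (eval c ω′ (probe Q second))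

  -- Kept opaque: only its specification matters, and unfolding the
  -- pigeonhole search would make type checking needlessly expensive.
  opaque
    collision : ∀ ω′ Q → Collision ω′ Q
    collision ω′ Q with pigeonhole (n<1+n (suc p′)) (λ i → fromℕ< (category< (eval c ω′ (probe Q i))))
    ... | i , j , i<j , same = record
      { first = i ; second = j ; ordered = i<j
      ; sameCategory = fromℕ<-injective _ _ (category< _) (category< _) same }

  -- The bits of stage n against candidate (ω , t , ω′): on chain 0 against
  -- the composite ω, on the chains of the two colliding probes against the
  -- sandwiches with table t and word ω′.
  stageBit : List ℕ × List ℕ × List ℕ → (ℕ → List Bool) → ℕ → Bool
  stageBit (ω , _ , _) Q zero = aim (eval c ω (witness Q 0))
  stageBit (_ , t , ω′) Q (suc l) =
    pick (toℕ first) (toℕ second) (aim (nth t (proj₁ positions))) (aim (nth t (proj₂ positions))) l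
    where open Collision (collision ω′ Q)

  prefixes : ℕ → ℕ → List Bool
  prefixes zero l = []
  prefixes (suc n) l = prefixes n l ∷ʳ stageBit (candidates n) (prefixes n) l

  branch : ℕ → ℕ → Bool
  branch l n = stageBit (candidates n) (prefixes n) l

  prefixes-branch : ∀ n l → prefixes n l ≡ applyUpTo (branch l) n
  prefixes-branch zero l = refl
  prefixes-branch (suc n) l =
    trans (cong (_∷ʳ branch l n) (prefixes-branch n l)) (applyUpTo-∷ʳ (branch l) n)

  diagonal : Map
  diagonal x with x <? r
  ... | yes _ = x
  ... | no _ with chain r x <? p
  ... | yes _ = indicator (above (word r x) (branch (chain r x)))
  ... | no _ = 0

  diagonal-on-chain : ∀ x → r ≤ x → chain r x < p →
                      diagonal x ≡ indicator (above (word r x) (branch (chain r x)))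
  diagonal-on-chain x r≤x l<p with x <? r
  ... | yes x<r = contradiction r≤x (<⇒≱ x<r)
  ... | no _ with chain r x <? p
  ... | yes _ = refl
  ... | no l≮p = contradiction l<p l≮p

  diagonal-cutMap : CutMap r p diagonal
  diagonal-cutMap = record
    { fixes = fixes′ ; binary = binary′ ; vanishes = vanishes′
    ; monotone = monotone′ }
    where
    monotone′ : ∀ x y → r ≤ x → r ≤ y → chain r x ≡ chain r y → chain r x < p →
                word r x ⊑ word r y ≡ true → diagonal x ≤ diagonal y
    monotone′ x y rx ry hc hp hl = begin
      diagonal x                                          ≡⟨ diagonal-on-chain x rx hp ⟩
      indicator (above (word r x) (branch (chain r x)))   ≤⟨ indicator-mono (above-upward (word r x) (word r y) (branch (chain r x)) hl) ⟩
      indicator (above (word r y) (branch (chain r x)))   ≡⟨ cong (λ l → indicator (above (word r y) (branch l))) hc ⟩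
      indicator (above (word r y) (branch (chain r y)))   ≡⟨ diagonal-on-chain y ry (subst (_< p) hc hp) ⟨
      diagonal y                                          ∎
      where open ≤-Reasoning
    fixes′ : ∀ x → x < r → diagonal x ≡ x
    fixes′ x x<r with x <? r
    ... | yes _ = refl
    ... | no x≮r = contradiction x<r x≮r
    binary′ : ∀ x → r ≤ x → diagonal x ≤ 1
    binary′ x r≤x with x <? r
    ... | yes x<r = contradiction r≤x (<⇒≱ x<r)
    ... | no _ with chain r x <? p
    ... | yes _ = indicator-≤1 _
    ... | no _ = z≤n
    vanishes′ : ∀ x → r ≤ x → p ≤ chain r x → diagonal x ≡ 0
    vanishes′ x r≤x p≤l with x <? r
    ... | yes x<r = contradiction r≤x (<⇒≱ x<r)
    ... | no _ with chain r x <? p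
    ... | yes l<p = contradiction p≤l (<⇒≱ l<p)
    ... | no _ = refl

  diagonal-aims : ∀ n l z → l < p → branch l n ≡ aim z → diagonal (witness (prefixes n) l) ≡ avoid z
  diagonal-aims n l z l<p bit = begin
    diagonal y                                              ≡⟨ diagonal-on-chain y (point-≥ r l (prefixes n l)) (subst (_< p) (sym onLabelChain) l<p) ⟩
    indicator (above (word r y) (branch (chain r y)))       ≡⟨ cong₂ (λ s k → indicator (above s (branch k))) onLabelWord onLabelChain ⟩
    indicator (above (prefixes n l) (branch l))             ≡⟨ cong (λ s → indicator (above s (branch l))) (prefixes-branch n l) ⟩
    indicator (above (applyUpTo (branch l) n) (branch l))   ≡⟨ cong indicator (above-prefix n (branch l)) ⟩
    indicator (not (branch l n))                            ≡⟨ cong (indicator ∘ not) bit ⟩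
    indicator (not (aim z))                                 ≡⟨ indicator-aim z ⟩
    avoid z                                                 ∎
    where
    open ≡-Reasoning
    y = witness (prefixes n) l
    onLabelChain : chain r y ≡ l
    onLabelChain = cong proj₁ (point-label r l (prefixes n l))
    onLabelWord : word r y ≡ prefixes n l
    onLabelWord = cong proj₂ (point-label r l (prefixes n l))

  not-composite : 0 < p → ¬ Composite c diagonal
  not-composite p>0 (ω , q) with candidates-enumerate (ω , [] , [])
  ... | n , en = avoid-≢ z (trans (sym (diagonal-aims n 0 z p>0 bit)) (q y))
    where
    y = witness (prefixes n) 0
    z = eval c ω y
    bit : branch 0 n ≡ aim z
    bit = cong (λ cand → stageBit cand (prefixes n) 0) en

  -- Chains 1 … p′ + 2 defeat every sandwich for (r′ , p′): at the two
  -- colliding probes the diagonal avoids the table values at both target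
  -- positions, yet the sandwich must hit one of them.
  not-sandwich : p′ + 3 ≤ p → ¬ Sandwich r′ p′ c diagonal
  not-sandwich bound (t , ω′ , w , W , q) with candidates-enumerate ([] , t , ω′)
  ... | n , en = [ miss first (proj₁ positions) value-first , miss second (proj₂ positions) value-second ]
                   (hits-target _ _ W sameCategory)
    where
    Q = prefixes n
    open Collision (collision ω′ Q)

    probed : ∀ i → suc (toℕ i) < p
    probed i = ≤-trans (s≤s (toℕ<n i)) (subst (_≤ p) (+-comm p′ 3) bound)

    bit : ∀ l → branch (suc l) n ≡ pick (toℕ first) (toℕ second) (aim (nth t (proj₁ positions))) (aim (nth t (proj₂ positions))) l
    bit l = cong (λ cand → stageBit cand Q (suc l)) en

    value-first : diagonal (probe Q first) ≡ avoid (nth t (proj₁ positions))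
    value-first = diagonal-aims n (suc (toℕ first)) (nth t (proj₁ positions)) (probed first)
      (trans (bit (toℕ first)) (pick-first (toℕ first) (toℕ second) _ _))

    value-second : diagonal (probe Q second) ≡ avoid (nth t (proj₂ positions))
    value-second = diagonal-aims n (suc (toℕ second)) (nth t (proj₂ positions)) (probed second)
      (trans (bit (toℕ second)) (pick-second (toℕ first) (toℕ second) _ _ λ e → <-irrefl (sym e) ordered))

    miss : ∀ i k → diagonal (probe Q i) ≡ avoid (nth t k) → w (eval c ω′ (probe Q i)) ≡ k → ⊥
    miss i k value hit = avoid-≢ (nth t k) (trans (sym value) (trans (q (probe Q i)) (cong (nth t) hit)))

-- The cut maps for (r , p) are not generated by those for (r′ , p′) together
-- with countably many further maps when r′ < r or p′ + 3 ≤ p: the diagonal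
-- map is neither a composite of the extra maps, nor a sandwich (a sandwich
-- takes at most r′ < r values, and otherwise not-sandwich applies).
separation : ∀ {r p r′ p′} → 2 ≤ r′ → 0 < p → r′ < r ⊎ p′ + 3 ≤ p → ¬ (CutMap r p ≼ CutMap r′ p′)
separation {r} {p} {r′} {p′} r′≥2 p>0 gap (c , covered) =
  refute (normal-form (covered diagonal diagonal-cutMap)) gap
  where
  open Diagonal r p r′ p′ c
  open NormalForm r′ p′ r′≥2 c
  refute : NF diagonal → r′ < r ⊎ p′ + 3 ≤ p → ⊥
  refute (inj₁ composite) _ = not-composite p>0 composite
  refute (inj₂ sandwich) (inj₁ r′<r) = many-values diagonal-cutMap r′<r (sandwich-few-values sandwich)
  refute (inj₂ sandwich) (inj₂ bound) = not-sandwich bound sandwich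

⊆⇒≼ : ∀ {U V} → U ⊆ V → U ≼ V
⊆⇒≼ U⊆V = (λ _ _ → 0) , λ f u → base f (inj₁ (U⊆V f u)) (λ _ → refl)

-- The j-th of i subsemigroups: along j the parameter r increases by 1 and
-- p decreases by 3, so each pair is separated in both directions.
family : (i : ℕ) → Fin i → Subset
family i j = CutMap (toℕ j + 2) (3 * (i ∸ toℕ j))

family-r≥2 : ∀ {i} (j : Fin i) → 2 ≤ toℕ j + 2
family-r≥2 j = m≤n+m 2 (toℕ j)

family-p>0 : ∀ i (j : Fin i) → 0 < 3 * (i ∸ toℕ j)
family-p>0 i j = ≤-trans (m<n⇒0<n∸m (toℕ<n j)) (m≤n*m (i ∸ toℕ j) 3)

family-gap : ∀ i (j k : Fin i) → toℕ j < toℕ k → 3 * (i ∸ toℕ k) + 3 ≤ 3 * (i ∸ toℕ j)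
family-gap i j k j<k = begin
  3 * (i ∸ toℕ k) + 3    ≡⟨ +-comm (3 * (i ∸ toℕ k)) 3 ⟩
  3 + 3 * (i ∸ toℕ k)    ≡⟨ *-suc 3 (i ∸ toℕ k) ⟨
  3 * suc (i ∸ toℕ k)    ≤⟨ *-monoʳ-≤ 3 (∸-monoʳ-< j<k (<⇒≤ (toℕ<n k))) ⟩
  3 * (i ∸ toℕ j)        ∎
  where open ≤-Reasoning

family-incomparable-< : ∀ i (j k : Fin i) → toℕ j < toℕ k → Incomparable (family i j) (family i k)
family-incomparable-< i j k j<k =
  separation (family-r≥2 k) (family-p>0 i j) (inj₂ (family-gap i j k j<k)) ,
  separation (family-r≥2 j) (family-p>0 i k) (inj₁ (+-monoˡ-< 2 j<k))

family-incomparable : ∀ i (j k : Fin i) → ¬ (j ≡ k) → Incomparable (family i j) (family i k)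
family-incomparable i j k j≢k with <-cmp (toℕ j) (toℕ k)
... | tri< j<k _ _ = family-incomparable-< i j k j<k
... | tri≈ _ j≡k _ = contradiction (toℕ-injective j≡k) j≢k
... | tri> _ _ k<j = Product.swap (family-incomparable-< i k j k<j)

theorem5p1 : (i : ℕ) → Σ (Fin i → Subset) λ S →
    ((j : Fin i) → IsClosed (S j) × IsSubsemigroup (S j) × (S j ⊆ 𝔉))
    × ((j k : Fin i) → ¬ (j ≡ k) → ¬ (S j ≐ S k) × Incomparable (S j) (S k))
theorem5p1 i = family i , properties , separated
  where
  properties : ∀ j → IsClosed (family i j) × IsSubsemigroup (family i j) × (family i j ⊆ 𝔉)
  properties j = cutMap-closed , cutMap-semigroup (family-r≥2 j) , cutMap-finite (family-r≥2 j)
  separated : ∀ j k → ¬ (j ≡ k) → ¬ (family i j ≐ family i k) × Incomparable (family i j) (family i k)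
  separated j k j≢k = (λ same → proj₁ incomparable (⊆⇒≼ (proj₁ same))) , incomparable
    where
    incomparable : Incomparable (family i j) (family i k)
    incomparable = family-incomparable i j k j≢k
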